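{- Let $G$ be a graph with $n$ vertices and $k$ a nonnegative integer such that $G$ has no loops, every edge has multiplicity at most $2$, every vertex has degree at least $3$, and some vertex has degree at least $4$. Suppose $n\ge 4k$ and $G$ has a feedback vertex set of size at most $k$. Sample a vertex $v$ with probability $(\deg(v)-3)/\sum_{u\in V}(\deg(u)-3)$. Then with probability at least $1/2$, $v$ belongs to a feedback vertex set of $G$ of size at most $k$ (equivalently, $G-v$ has a feedback vertex set of size at most $k-1$).
   Context: Graphs may have parallel edges; degrees count edge multiplicities. A feedback vertex set of $G=(V,E)$ is a set $F\subseteq V$ such that $G[V\setminus F]$ is a forest (acyclic, where a pair of parallel edges forms a cycle). -}

module Defs where

open import Data.Nat using (ℕ; zero; suc; _+_; _*_; _∸_; _≤_)
open import Data.Fin using (Fin; zero; suc; _≟_)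
open import Data.Fin.Subset using (Subset; _∈_; _∉_; ∣_∣)
open import Data.Fin.Subset.Properties using (_∈?_)
open import Data.List using (List; map; allFin)
open import Data.Nat.ListAction using (sum)
open import Data.Product using (Σ; _×_; _,_; proj₁; proj₂; ∃)
open import Data.Sum using (_⊎_)
open import Function using (Injective)
open import Relation.Nullary using (¬_; does)
open import Relation.Nullary.Decidable using (⌊_⌋)
open import Data.Bool using (Bool; true; false; if_then_else_; _∨_; _∧_)
open import Relation.Binary.PropositionalEquality using (_≡_)

-- A multigraph on vertex set Fin n: finitely many edges, indexed by Fin nE,
-- each edge given by its (ordered, but read as unordered) pair of endpoints.
record Graph (n : ℕ) : Set where
  field
    nE   : ℕ
    ends : Fin nE → Fin n × Fin n
open Graph public

sumFin : ∀ {m} → (Fin m → ℕ) → ℕ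
sumFin {m} f = sum (map f (allFin m))

ind : Bool → ℕ
ind true  = 1
ind false = 0

-- degree: number of edge-endpoints equal to v (loops would count twice)
deg : ∀ {n} → Graph n → Fin n → ℕ
deg G v = sumFin (λ e → ind ⌊ proj₁ (ends G e) ≟ v ⌋ + ind ⌊ proj₂ (ends G e) ≟ v ⌋)

Joins : ∀ {n} (G : Graph n) → Fin (nE G) → Fin n → Fin n → Set
Joins G e u v = (ends G e ≡ (u , v)) ⊎ (ends G e ≡ (v , u))

joins? : ∀ {n} (G : Graph n) → Fin (nE G) → Fin n → Fin n → Bool
joins? G e u v =
  (⌊ proj₁ (ends G e) ≟ u ⌋ ∧ ⌊ proj₂ (ends G e) ≟ v ⌋) ∨
  (⌊ proj₁ (ends G e) ≟ v ⌋ ∧ ⌊ proj₂ (ends G e) ≟ u ⌋)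

mult : ∀ {n} → Graph n → Fin n → Fin n → ℕ
mult G u v = sumFin (λ e → ind (joins? G e u v))

NoLoops : ∀ {n} → Graph n → Set
NoLoops G = ∀ e → ¬ (proj₁ (ends G e) ≡ proj₂ (ends G e))

-- cyclic successor on Fin (suc k): i ↦ i+1 mod (k+1)
next : ∀ {k} → Fin (suc k) → Fin (suc k)
next {zero}  zero    = zero
next {suc k} zero    = suc zero
next {suc k} (suc i) with next {k} i
... | zero  = zero
... | suc j = suc (suc j)

-- A cycle of length L = suc k in G avoiding the vertex set F:
-- distinct vertices vs 0, …, vs k (none in F) and distinct edges es 0, …, es k
-- such that edge es i joins vs i and vs (i+1 mod L).
-- (Length 2 = a pair of parallel edges; length 1 = a loop.)
record CycleAvoiding {n} (G : Graph n) (F : Subset n) : Set where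
  field
    k     : ℕ
    vs    : Fin (suc k) → Fin n
    es    : Fin (suc k) → Fin (nE G)
    vsInj : Injective _≡_ _≡_ vs
    esInj : Injective _≡_ _≡_ es
    vsOut : ∀ i → vs i ∉ F
    link  : ∀ i → Joins G (es i) (vs i) (vs (next i))

-- F is a feedback vertex set: G[V ∖ F] is a forest (has no cycle)
IsFVS : ∀ {n} → Graph n → Subset n → Set
IsFVS G F = ¬ CycleAvoiding G F

InSmallFVS : ∀ {n} → Graph n → ℕ → Fin n → Set
InSmallFVS G k v = Σ (Subset _) λ F → IsFVS G F × ∣ F ∣ ≤ k × v ∈ F

-- sampling weight deg(v) − 3 (hypotheses guarantee deg v ≥ 3)
weight : ∀ {n} → Graph n → Fin n → ℕ
weight G v = deg G v ∸ 3

weightOf : ∀ {n} → Graph n → Subset n → ℕ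
weightOf G S = sumFin (λ v → if does (v ∈? S) then weight G v else 0)

totalWeight : ∀ {n} → Graph n → ℕ
totalWeight G = sumFin (weight G)

module Submission where

-- Lemma 5: with X a feedback vertex set of size at most k ≤ n/4 in a loopless
-- graph of minimum degree 3, at least half of the total weight Σ (deg v − 3)
-- sits on vertices of X, and so on the set S of vertices lying in some
-- feedback vertex set of size ≤ k.  The weight estimate is a counting argument
-- on B = V ∖ X:
--   w(B) + 3|B| = deg(B) ≤ deg(X) + 2 e(B) ≤ w(X) + 3|X| + 2|B| ≤ w(X) + 3|B|,
-- where e(B) ≤ |B| because G[B] is a forest and 3|X| ≤ |B| because 4|X| ≤ n.

open import Defs
open import Data.Nat using (ℕ; zero; suc; _+_; _*_; _∸_; _≤_; _<_; z≤n; s≤s; _≤?_)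
open import Data.Nat.Properties hiding (_≟_)
open import Data.Fin using (Fin; zero; suc; _≟_; toℕ; fromℕ<)
open import Data.Fin.Properties using (any?; all?; toℕ-fromℕ<; injective⇒≤; toℕ-injective; toℕ<n)
open import Data.Fin.Subset using (Subset; _∈_; _∉_; _⊆_; ∣_∣)
open import Data.Fin.Subset.Properties using (_∈?_; anySubset?)
open import Data.List using (map)
import Data.List as List
import Data.Nat.ListAction as ListAction
open import Data.Vec using (_∷_; []; tabulate)
open import Data.Vec.Properties using ([]=⇒lookup; lookup⇒[]=; lookup∘tabulate)
open import Data.Product using (Σ; ∃; _×_; _,_; proj₁; proj₂)
open import Data.Product.Properties using (≡-dec)
open import Data.Sum using (_⊎_; inj₁; inj₂)
open import Data.Empty using (⊥; ⊥-elim)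
open import Data.Bool using (Bool; true; false; if_then_else_; _∧_; not)
import Data.Bool as Bool
open import Relation.Nullary using (Dec; yes; no; does)
import Relation.Nullary.Decidable as Dec
open import Relation.Nullary.Decidable using (⌊_⌋; _×-dec_; _⊎-dec_; _→-dec_; ¬?)
open import Relation.Binary.PropositionalEquality
open import Function using (_∘_; Injective)
open import Algebra.Properties.Semiring.Sum +-*-semiring
  using (∑-distrib-+; ∑-comm; *-distribˡ-sum; sum-cong-≗; sum-replicate-zero)
  renaming (sum to ∑)

∑-tabulate : ∀ {m p} (f : Fin p → ℕ) (g : Fin m → Fin p) →
  ListAction.sum (map f (List.tabulate g)) ≡ ∑ (f ∘ g)
∑-tabulate {zero}  f g = refl
∑-tabulate {suc m} f g = cong (f (g zero) +_) (∑-tabulate f (g ∘ suc))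

sumFin≡∑ : ∀ {m} (f : Fin m → ℕ) → sumFin f ≡ ∑ f
sumFin≡∑ f = ∑-tabulate f (λ i → i)

∑-mono : ∀ {m} {f g : Fin m → ℕ} → (∀ i → f i ≤ g i) → ∑ f ≤ ∑ g
∑-mono {zero}  f≤g = z≤n
∑-mono {suc m} f≤g = +-mono-≤ (f≤g zero) (∑-mono (f≤g ∘ suc))

∑-vanishing : ∀ {m} (f : Fin m → ℕ) → (∀ i → f i ≡ 0) → ∑ f ≡ 0
∑-vanishing {m} f f≡0 = trans (sum-cong-≗ f≡0) (sum-replicate-zero m)

∑-ones : ∀ m → ∑ {m} (λ _ → 1) ≡ m
∑-ones zero    = refl
∑-ones (suc m) = cong suc (∑-ones m)

mask : Bool → ℕ → ℕ
mask b x = if b then x else 0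

mask-+ : ∀ b x y → mask b (x + y) ≡ mask b x + mask b y
mask-+ true  x y = refl
mask-+ false x y = refl

mask-∑ : ∀ {m} b (f : Fin m → ℕ) → mask b (∑ f) ≡ ∑ (mask b ∘ f)
mask-∑ true  f = refl
mask-∑ false f = sym (∑-vanishing (mask false ∘ f) (λ _ → refl))

mask-split : ∀ b x → x ≡ mask b x + mask (not b) x
mask-split true  x = sym (+-identityʳ x)
mask-split false x = refl

mask-zero : ∀ b → mask b 0 ≡ 0
mask-zero true  = refl
mask-zero false = refl

∑-point : ∀ {m} (c : Fin m → Bool) (a : Fin m) →
  ∑ (λ v → mask (c v) (ind ⌊ a ≟ v ⌋)) ≡ ind (c a)
∑-point c zero with c zero
... | true  = cong suc (∑-vanishing _ (λ v → mask-zero (c (suc v))))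
... | false = ∑-vanishing _ (λ v → mask-zero (c (suc v)))
∑-point c (suc a) = cong₂ _+_ (mask-zero (c zero))
  (trans (sum-cong-≗ (λ v → cong (mask (c (suc v)) ∘ ind) (≟-suc a v))) (∑-point (c ∘ suc) a))
  where ≟-suc : ∀ {m} (a v : Fin m) → ⌊ suc a ≟ suc v ⌋ ≡ ⌊ a ≟ v ⌋
        ≟-suc a v with a ≟ v
        ... | yes _ = refl
        ... | no  _ = refl

size : ∀ {m} → (Fin m → Bool) → ℕ
size c = ∑ (λ v → ind (c v))

size-split : ∀ {m} (c : Fin m → Bool) → size c + size (not ∘ c) ≡ m
size-split {m} c = begin
  size c + size (not ∘ c)                 ≡⟨ ∑-distrib-+ (ind ∘ c) (ind ∘ not ∘ c) ⟨
  ∑ (λ v → ind (c v) + ind (not (c v)))   ≡⟨ sum-cong-≗ (λ v → ind-split (c v)) ⟩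
  ∑ {m} (λ _ → 1)                         ≡⟨ ∑-ones m ⟩
  m                                       ∎
  where
  open ≡-Reasoning
  ind-split : ∀ b → ind b + ind (not b) ≡ 1
  ind-split true  = refl
  ind-split false = refl

size-subset : ∀ {n} (X : Subset n) → size (λ v → does (v ∈? X)) ≡ ∣ X ∣
size-subset []          = refl
size-subset (true  ∷ X) = cong suc (size-subset X)
size-subset (false ∷ X) = size-subset X

DistinctBelow : ∀ {n} → (ℕ → Fin n) → ℕ → Set
DistinctBelow W j = ∀ x y → x < j → y < j → W x ≡ W y → x ≡ y

record FirstRepeat {n} (W : ℕ → Fin n) : Set where
  field
    i j      : ℕ
    i<j      : i < j
    repeats  : W j ≡ W i
    distinct : DistinctBelow W j

distinct-or-repeat : ∀ {n} (W : ℕ → Fin n) m → DistinctBelow W (suc m) ⊎ FirstRepeat W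
distinct-or-repeat W zero = inj₁ (λ { x y (s≤s z≤n) (s≤s z≤n) _ → refl })
distinct-or-repeat W (suc m) with distinct-or-repeat W m
... | inj₂ r = inj₂ r
... | inj₁ dist with any? (λ (x : Fin (suc m)) → W (toℕ x) ≟ W (suc m))
...   | yes (x , Wx≡) = inj₂ (record
          { i = toℕ x ; j = suc m ; i<j = toℕ<n x ; repeats = sym Wx≡ ; distinct = dist })
...   | no fresh = inj₁ dist′
  where
  hit : ∀ {x} → x < suc m → W x ≡ W (suc m) → ⊥
  hit {x} x<1+m eq = fresh (fromℕ< x<1+m , trans (cong W (toℕ-fromℕ< x<1+m)) eq)
  dist′ : DistinctBelow W (suc (suc m))
  dist′ x y x< y< eq with m<1+n⇒m<n∨m≡n x< | m<1+n⇒m<n∨m≡n y<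
  ... | inj₁ x<  | inj₁ y<  = dist x y x< y< eq
  ... | inj₂ refl | inj₂ refl = refl
  ... | inj₁ x<  | inj₂ refl = ⊥-elim (hit x< eq)
  ... | inj₂ refl | inj₁ y<  = ⊥-elim (hit y< (sym eq))

-- Pigeonhole: a sequence in Fin n repeats within its first n+1 values.
first-repeat : ∀ {n} (W : ℕ → Fin n) → FirstRepeat W
first-repeat {n} W with distinct-or-repeat W n
... | inj₂ r    = r
... | inj₁ dist = ⊥-elim (1+n≰n (injective⇒≤ {f = W ∘ toℕ}
        (λ {s} {t} eq → toℕ-injective (dist (toℕ s) (toℕ t) (toℕ<n s) (toℕ<n t) eq))))

next-toℕ : ∀ {k} (t : Fin (suc k)) → toℕ (next t) ≡ suc (toℕ t) ⊎ (toℕ t ≡ k × toℕ (next t) ≡ 0)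
next-toℕ {zero}  zero    = inj₂ (refl , refl)
next-toℕ {suc k} zero    = inj₁ refl
next-toℕ {suc k} (suc i) with next {k} i | next-toℕ {k} i
... | zero  | inj₂ (i≡k , _) = inj₂ (cong suc i≡k , refl)
... | suc j | inj₁ eq        = inj₁ (cong suc eq)

module _ {n} (G : Graph n) where

  src tgt : Fin (nE G) → Fin n
  src e = proj₁ (ends G e)
  tgt e = proj₂ (ends G e)

  endsAt : Fin (nE G) → Fin n → ℕ
  endsAt e v = ind ⌊ src e ≟ v ⌋ + ind ⌊ tgt e ≟ v ⌋

  internal : (Fin n → Bool) → Fin (nE G) → Bool
  internal c e = c (src e) ∧ c (tgt e)

  edgesWithin : (Fin n → Bool) → ℕ
  edgesWithin c = size (internal c)

  degWithin : (Fin n → Bool) → Fin n → ℕ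
  degWithin c v = ∑ (λ e → mask (internal c e) (endsAt e v))

  degree-sum : ∀ (c : Fin n → Bool) →
    ∑ (λ v → mask (c v) (deg G v)) ≡ ∑ (λ e → ind (c (src e)) + ind (c (tgt e)))
  degree-sum c = begin
    ∑ (λ v → mask (c v) (deg G v))
      ≡⟨ sum-cong-≗ (λ v → trans (cong (mask (c v)) (sumFin≡∑ (λ e → endsAt e v))) (mask-∑ (c v) (λ e → endsAt e v))) ⟩
    ∑ (λ v → ∑ (λ e → mask (c v) (endsAt e v)))
      ≡⟨ ∑-comm (λ v e → mask (c v) (endsAt e v)) ⟩
    ∑ (λ e → ∑ (λ v → mask (c v) (endsAt e v)))
      ≡⟨ sum-cong-≗ (λ e → ends-in-c e) ⟩
    ∑ (λ e → ind (c (src e)) + ind (c (tgt e)))  ∎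
    where
    open ≡-Reasoning
    ends-in-c : ∀ e → ∑ (λ v → mask (c v) (endsAt e v)) ≡ ind (c (src e)) + ind (c (tgt e))
    ends-in-c e = begin
      ∑ (λ v → mask (c v) (endsAt e v))
        ≡⟨ sum-cong-≗ (λ v → mask-+ (c v) (ind ⌊ src e ≟ v ⌋) (ind ⌊ tgt e ≟ v ⌋)) ⟩
      ∑ (λ v → mask (c v) (ind ⌊ src e ≟ v ⌋) + mask (c v) (ind ⌊ tgt e ≟ v ⌋))
        ≡⟨ ∑-distrib-+ (λ v → mask (c v) (ind ⌊ src e ≟ v ⌋)) (λ v → mask (c v) (ind ⌊ tgt e ≟ v ⌋)) ⟩
      ∑ (λ v → mask (c v) (ind ⌊ src e ≟ v ⌋)) + ∑ (λ v → mask (c v) (ind ⌊ tgt e ≟ v ⌋))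
        ≡⟨ cong₂ _+_ (∑-point c (src e)) (∑-point c (tgt e)) ⟩
      ind (c (src e)) + ind (c (tgt e))  ∎

  -- Every edge end in the complement of c either belongs to an edge leaving c
  -- (and is matched by an end in c) or to an edge inside the complement.
  degree-split : ∀ (c : Fin n → Bool) →
    ∑ (λ v → mask (not (c v)) (deg G v))
      ≤ ∑ (λ v → mask (c v) (deg G v)) + 2 * edgesWithin (not ∘ c)
  degree-split c = begin
    ∑ (λ v → mask (not (c v)) (deg G v))
      ≡⟨ degree-sum (not ∘ c) ⟩
    ∑ (λ e → ind (not (c (src e))) + ind (not (c (tgt e))))
      ≤⟨ ∑-mono (λ e → edge-ends (c (src e)) (c (tgt e))) ⟩
    ∑ (λ e → (ind (c (src e)) + ind (c (tgt e))) + 2 * ind (internal (not ∘ c) e))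
      ≡⟨ ∑-distrib-+ (λ e → ind (c (src e)) + ind (c (tgt e))) (λ e → 2 * ind (internal (not ∘ c) e)) ⟩
    ∑ (λ e → ind (c (src e)) + ind (c (tgt e))) + ∑ (λ e → 2 * ind (internal (not ∘ c) e))
      ≡⟨ cong₂ _+_ (degree-sum c) (*-distribˡ-sum 2 (ind ∘ internal (not ∘ c))) ⟨
    ∑ (λ v → mask (c v) (deg G v)) + 2 * edgesWithin (not ∘ c)  ∎
    where
    open ≤-Reasoning
    edge-ends : ∀ x y → ind (not x) + ind (not y) ≤ (ind x + ind y) + 2 * ind (not x ∧ not y)
    edge-ends true  true  = z≤n
    edge-ends true  false = s≤s z≤n
    edge-ends false true  = s≤s z≤n
    edge-ends false false = s≤s (s≤s z≤n)

  _minus_ : (Fin n → Bool) → Fin n → (Fin n → Bool)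
  (c minus v) u = if ⌊ u ≟ v ⌋ then false else c u

  size-minus : ∀ c {v} → c v ≡ true → size c ≡ suc (size (c minus v))
  size-minus c {v} cv = begin
    size c                                                ≡⟨ sum-cong-≗ split ⟩
    ∑ (λ u → ind ((c minus v) u) + ind ⌊ v ≟ u ⌋)         ≡⟨ ∑-distrib-+ (ind ∘ (c minus v)) (λ u → ind ⌊ v ≟ u ⌋) ⟩
    size (c minus v) + ∑ (λ u → ind ⌊ v ≟ u ⌋)            ≡⟨ cong (size (c minus v) +_) (∑-point (λ _ → true) v) ⟩
    size (c minus v) + 1                                  ≡⟨ +-comm (size (c minus v)) 1 ⟩
    suc (size (c minus v))                                ∎
    where
    open ≡-Reasoning
    split : ∀ u → ind (c u) ≡ ind ((c minus v) u) + ind ⌊ v ≟ u ⌋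
    split u with u ≟ v | v ≟ u
    ... | yes refl | yes _   = cong ind cv
    ... | yes u≡v  | no v≢u  = ⊥-elim (v≢u (sym u≡v))
    ... | no  _    | no  _ = sym (+-identityʳ _)
    ... | no u≢v   | yes v≡u = ⊥-elim (u≢v (sym v≡u))

  -- An edge inside c is either inside c minus v or has an end at v.
  edgesWithin-minus : ∀ c v → edgesWithin c ≤ edgesWithin (c minus v) + degWithin c v
  edgesWithin-minus c v = begin
    edgesWithin c
      ≤⟨ ∑-mono (λ e → internal-minus (c (src e)) (c (tgt e)) ⌊ src e ≟ v ⌋ ⌊ tgt e ≟ v ⌋) ⟩
    ∑ (λ e → ind (internal (c minus v) e) + mask (internal c e) (endsAt e v))
      ≡⟨ ∑-distrib-+ (ind ∘ internal (c minus v)) (λ e → mask (internal c e) (endsAt e v)) ⟩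
    edgesWithin (c minus v) + degWithin c v  ∎
    where
    open ≤-Reasoning
    internal-minus : ∀ x y p q →
      ind (x ∧ y) ≤ ind ((if p then false else x) ∧ (if q then false else y)) + mask (x ∧ y) (ind p + ind q)
    internal-minus false y     p     q     = z≤n
    internal-minus true  false p     q     = z≤n
    internal-minus true  true  false false = ≤-refl
    internal-minus true  true  true  q     = s≤s z≤n
    internal-minus true  true  false true  = s≤s z≤n

  same-edge : ∀ {e a b a′ b′} → Joins G e a b → Joins G e a′ b′ →
    (a ≡ a′ × b ≡ b′) ⊎ (a ≡ b′ × b ≡ a′)
  same-edge (inj₁ p) (inj₁ q) = let r = trans (sym p) q in inj₁ (cong proj₁ r , cong proj₂ r)
  same-edge (inj₁ p) (inj₂ q) = let r = trans (sym p) q in inj₂ (cong proj₁ r , cong proj₂ r)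
  same-edge (inj₂ p) (inj₁ q) = let r = trans (sym p) q in inj₂ (cong proj₂ r , cong proj₁ r)
  same-edge (inj₂ p) (inj₂ q) = let r = trans (sym p) q in inj₁ (cong proj₂ r , cong proj₁ r)

  record Exit (c : Fin n → Bool) (w : Fin n) (f : Fin (nE G)) : Set where
    field
      target      : Fin n
      targetIn    : c target ≡ true
      edge        : Fin (nE G)
      edge≢f      : edge ≢ f
      edgeJoins   : Joins G edge w target

  -- In a loopless graph an edge meets w at most once, so if w has degree at
  -- least 2 in G[c], then for every edge f some other edge of G[c] leaves w.
  exit : NoLoops G → ∀ c w → 2 ≤ degWithin c w → (f : Fin (nE G)) → Exit c w f
  exit noLoops c w deg≥2 f
    with any? (λ e → ¬? (e ≟ f) ×-dec (internal c e Bool.≟ true) ×-dec ((src e ≟ w) ⊎-dec (tgt e ≟ w)))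
  ... | yes (e , e≢f , int , inj₁ src≡w) =
          record { target = tgt e ; targetIn = right (c (src e)) int ; edge = e ; edge≢f = e≢f
                 ; edgeJoins = inj₁ (cong (_, tgt e) src≡w) }
    where right : ∀ x {y} → x ∧ y ≡ true → y ≡ true
          right true eq = eq
  ... | yes (e , e≢f , int , inj₂ tgt≡w) =
          record { target = src e ; targetIn = left (c (src e)) int ; edge = e ; edge≢f = e≢f
                 ; edgeJoins = inj₂ (cong (src e ,_) tgt≡w) }
    where left : ∀ x {y} → x ∧ y ≡ true → x ≡ true
          left true _ = refl
  ... | no none = ⊥-elim (1+n≰n (begin
          2                                   ≤⟨ deg≥2 ⟩
          degWithin c w                       ≤⟨ ∑-mono only-f ⟩
          ∑ (λ e → mask true (ind ⌊ f ≟ e ⌋)) ≡⟨ ∑-point (λ _ → true) f ⟩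
          1                                   ∎))
    where
    open ≤-Reasoning
    only-f : ∀ e → mask (internal c e) (endsAt e w) ≤ ind ⌊ f ≟ e ⌋
    only-f e with internal c e in int | src e ≟ w | tgt e ≟ w | f ≟ e
    ... | false | _      | _      | _      = z≤n
    ... | true  | yes p  | yes q  | _      = ⊥-elim (noLoops e (trans p (sym q)))
    ... | true  | no _   | no _   | _      = z≤n
    ... | true  | yes _  | no _   | yes _  = ≤-refl
    ... | true  | no _   | yes _  | yes _  = ≤-refl
    ... | true  | yes p  | no _   | no f≢e = ⊥-elim (none (e , f≢e ∘ sym , int , inj₁ p))
    ... | true  | no _   | yes q  | no f≢e = ⊥-elim (none (e , f≢e ∘ sym , int , inj₂ q))

  record NonBacktrackingWalk (c : Fin n → Bool) : Set where
    field
      W           : ℕ → Fin n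
      E           : ℕ → Fin (nE G)
      inClass     : ∀ t → c (W t) ≡ true
      link        : ∀ t → Joins G (E t) (W t) (W (suc t))
      noBacktrack : ∀ t → E (suc t) ≢ E t

  drop-walk : ∀ {c} → NonBacktrackingWalk c → ℕ → NonBacktrackingWalk c
  drop-walk ω i = record
    { W           = λ t → W (i + t)
    ; E           = λ t → E (i + t)
    ; inClass     = λ t → inClass (i + t)
    ; link        = λ t → subst (Joins G (E (i + t)) (W (i + t))) (cong W (sym (+-suc i t))) (link (i + t))
    ; noBacktrack = λ t eq → noBacktrack (i + t) (trans (cong E (sym (+-suc i t))) eq)
    }
    where open NonBacktrackingWalk ω

  -- When every vertex of c has degree at least 2 in G[c], a walk never gets
  -- stuck: it can always leave its current vertex by an edge other than the
  -- one it arrived by.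
  walk-from : NoLoops G → ∀ c → (∀ v → c v ≡ true → 2 ≤ degWithin c v) →
    ∀ v → c v ≡ true → NonBacktrackingWalk c
  walk-from noLoops c deg≥2 v cv = record
    { W           = λ t → vertex (position t)
    ; E           = λ t → arrival (position (suc t))
    ; inClass     = λ t → vertexIn (position t)
    ; link        = λ t → Exit.edgeJoins (exitAt (position t))
    ; noBacktrack = λ t → Exit.edge≢f (exitAt (position (suc t)))
    }
    where
    record Position : Set where
      constructor at
      field
        vertex   : Fin n
        vertexIn : c vertex ≡ true
        arrival  : Fin (nE G)
    open Position

    exitAt : (p : Position) → Exit c (vertex p) (arrival p)
    exitAt p = exit noLoops c (vertex p) (deg≥2 (vertex p) (vertexIn p)) (arrival p)

    -- Any edge serves as the fictitious arrival edge at the start.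
    some-edge : ∀ {m} (h : Fin m → ℕ) → 1 ≤ ∑ h → Fin m
    some-edge {suc m} h _ = zero

    position : ℕ → Position
    position zero    = at v cv (some-edge _ (≤-trans (s≤s z≤n) (deg≥2 v cv)))
    position (suc t) = let x = exitAt (position t) in at (Exit.target x) (Exit.targetIn x) (Exit.edge x)

  module _ {c} (ω : NonBacktrackingWalk c) (d : ℕ)
           (closes   : NonBacktrackingWalk.W ω (suc d) ≡ NonBacktrackingWalk.W ω 0)
           (distinct : DistinctBelow (NonBacktrackingWalk.W ω) (suc d)) where
    open NonBacktrackingWalk ω

    -- Traversing an edge of the closed walk backwards can only happen for a
    -- cycle of length at most 2; length 2 would mean backtracking at step 0.
    no-reversal : ∀ S T → S < suc d → T < suc d →
      W S ≡ W (suc T) → W (suc S) ≡ W T → E S ≡ E T → S ≡ T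
    no-reversal S T S< T< p q eq with m<1+n⇒m<n∨m≡n S< | m<1+n⇒m<n∨m≡n T<
    ... | inj₁ S<d | inj₁ T<d with distinct S (suc T) S< (s≤s T<d) p
    ...   | refl = ⊥-elim (m+1+n≢n 1 (distinct (suc S) T (s≤s S<d) T< q))
    no-reversal S T S< T< p q eq | inj₁ S<d | inj₂ refl with distinct S 0 S< (s≤s z≤n) (trans p closes)
    ...   | refl = ⊥-elim (noBacktrack 0 (sym (subst (λ z → E 0 ≡ E z) (sym 1≡d) eq)))
      where 1≡d = distinct 1 d (s≤s S<d) T< q
    no-reversal S T S< T< p q eq | inj₂ refl | inj₁ T<d with distinct 0 T (s≤s z≤n) T< (trans (sym closes) q)
    ...   | refl = ⊥-elim (noBacktrack 0 (subst (λ z → E z ≡ E 0) (distinct d 1 S< (s≤s T<d) p) eq))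
    no-reversal S T S< T< p q eq | inj₂ refl | inj₂ refl = refl

    edges-distinct : ∀ S T → S < suc d → T < suc d → E S ≡ E T → S ≡ T
    edges-distinct S T S< T< eq
      with same-edge (link S) (subst (λ e → Joins G e (W T) (W (suc T))) (sym eq) (link T))
    ... | inj₁ (p , _) = distinct S T S< T< p
    ... | inj₂ (p , q) = no-reversal S T S< T< p q eq

    cycle-of-closed-walk : ∀ {X} → (∀ u → c u ≡ true → u ∉ X) → CycleAvoiding G X
    cycle-of-closed-walk avoid = record
      { k     = d
      ; vs    = W ∘ toℕ
      ; es    = E ∘ toℕ
      ; vsInj = λ {s} {t} eq → toℕ-injective (distinct (toℕ s) (toℕ t) (toℕ<n s) (toℕ<n t) eq)
      ; esInj = λ {s} {t} eq → toℕ-injective (edges-distinct (toℕ s) (toℕ t) (toℕ<n s) (toℕ<n t) eq)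
      ; vsOut = λ t → avoid (W (toℕ t)) (inClass (toℕ t))
      ; link  = cyclic-link
      }
      where
      cyclic-link : ∀ t → Joins G (E (toℕ t)) (W (toℕ t)) (W (toℕ (next t)))
      cyclic-link t with next-toℕ t
      ... | inj₁ eq          = subst (Joins G (E (toℕ t)) (W (toℕ t))) (cong W (sym eq)) (link (toℕ t))
      ... | inj₂ (t≡d , eq) = subst (Joins G (E (toℕ t)) (W (toℕ t)))
                                 (trans (cong (W ∘ suc) t≡d) (trans closes (cong W (sym eq)))) (link (toℕ t))

  -- Every non-backtracking walk closes up into a cycle: cut it at its first
  -- repeated vertex.
  walk-cycle : ∀ {c X} → NonBacktrackingWalk c → (∀ u → c u ≡ true → u ∉ X) → CycleAvoiding G X
  walk-cycle ω avoid = cycle-of-closed-walk (drop-walk ω i) d closes distinct′ avoid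
    where
    open NonBacktrackingWalk ω
    open FirstRepeat (first-repeat W)
    d = j ∸ suc i
    i+[1+d]≡j : i + suc d ≡ j
    i+[1+d]≡j = trans (+-suc i d) (m+[n∸m]≡n i<j)
    closes : W (i + suc d) ≡ W (i + 0)
    closes = trans (cong W i+[1+d]≡j) (trans repeats (cong W (sym (+-identityʳ i))))
    distinct′ : DistinctBelow (λ t → W (i + t)) (suc d)
    distinct′ x y x< y< eq = +-cancelˡ-≡ i x y (distinct (i + x) (i + y) (below x<) (below y<) eq)
      where below : ∀ {z} → z < suc d → i + z < j
            below {z} z< = subst (i + z <_) i+[1+d]≡j (+-monoʳ-< i z<)

  -- Peel off vertices of
  -- degree ≤ 1 in G[c]; once none is left, a nonempty class would carry a
  -- non-backtracking walk and hence a cycle, so the class is empty.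
  forest-sparse : NoLoops G → ∀ {X} → IsFVS G X →
    ∀ c → (∀ u → c u ≡ true → u ∉ X) → edgesWithin c ≤ size c
  forest-sparse noLoops {X} fvs c avoid = peel (size c) c avoid refl
    where
    peel : ∀ m c → (∀ u → c u ≡ true → u ∉ X) → size c ≡ m → edgesWithin c ≤ m
    peel m c avoid sz with any? (λ v → (c v Bool.≟ true) ×-dec (degWithin c v ≤? 1))
    peel zero c avoid sz | yes (v , cv , low) = ⊥-elim (1+n≢0 (trans (sym (size-minus c cv)) sz))
    peel (suc m) c avoid sz | yes (v , cv , low) = begin
      edgesWithin c                              ≤⟨ edgesWithin-minus c v ⟩
      edgesWithin (c minus v) + degWithin c v    ≤⟨ +-mono-≤ (peel m (c minus v) avoid′ sz′) low ⟩
      m + 1                                      ≡⟨ +-comm m 1 ⟩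
      suc m                                      ∎
      where
      open ≤-Reasoning
      sz′ : size (c minus v) ≡ m
      sz′ = suc-injective (trans (sym (size-minus c cv)) sz)
      avoid′ : ∀ u → (c minus v) u ≡ true → u ∉ X
      avoid′ u cu with u ≟ v
      ... | no _ = avoid u cu
    ... | no noLow with any? (λ v → c v Bool.≟ true)
    ...   | yes (v , cv) = ⊥-elim (fvs (walk-cycle (walk-from noLoops c deg≥2 v cv) avoid))
      where
      deg≥2 : ∀ v → c v ≡ true → 2 ≤ degWithin c v
      deg≥2 v cv with degWithin c v ≤? 1
      ... | yes low = ⊥-elim (noLow (v , cv , low))
      ... | no ¬low = ≰⇒> ¬low
    ...   | no empty = ≤-trans (≤-reflexive (∑-vanishing (ind ∘ internal c) no-edge)) z≤n
      where
      no-edge : ∀ e → ind (internal c e) ≡ 0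
      no-edge e with c (src e) in cs
      ... | true  = ⊥-elim (empty (src e , cs))
      ... | false = refl

  weightIn : (Fin n → Bool) → ℕ
  weightIn c = ∑ (λ v → mask (c v) (weight G v))

  weight-shift : (∀ v → 3 ≤ deg G v) → ∀ c →
    weightIn c + 3 * size c ≡ ∑ (λ v → mask (c v) (deg G v))
  weight-shift deg≥3 c = begin
    weightIn c + 3 * size c
      ≡⟨ cong (weightIn c +_) (*-distribˡ-sum 3 (ind ∘ c)) ⟩
    weightIn c + ∑ (λ v → 3 * ind (c v))
      ≡⟨ ∑-distrib-+ (λ v → mask (c v) (weight G v)) (λ v → 3 * ind (c v)) ⟨
    ∑ (λ v → mask (c v) (weight G v) + 3 * ind (c v))
      ≡⟨ sum-cong-≗ (λ v → shift (c v) (deg≥3 v)) ⟩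
    ∑ (λ v → mask (c v) (deg G v))  ∎
    where
    open ≡-Reasoning
    shift : ∀ b {x} → 3 ≤ x → mask b (x ∸ 3) + 3 * ind b ≡ mask b x
    shift true  3≤x = m∸n+n≡m 3≤x
    shift false _   = refl

lighter : ∀ P Q x b → Q + 3 * b ≤ (P + 3 * x) + 2 * b → 3 * x ≤ b → Q ≤ P
lighter P Q x b hyp 3x≤b = +-cancelʳ-≤ (3 * b) Q P (begin
  Q + 3 * b             ≤⟨ hyp ⟩
  (P + 3 * x) + 2 * b   ≤⟨ +-monoˡ-≤ (2 * b) (+-monoʳ-≤ P 3x≤b) ⟩
  (P + b) + 2 * b       ≡⟨ +-assoc P b (2 * b) ⟩
  P + 3 * b             ∎)
  where open ≤-Reasoning

module _ {n} (G : Graph n) where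

  complement-lighter : NoLoops G → (∀ v → 3 ≤ deg G v) → ∀ {X} → IsFVS G X → 4 * ∣ X ∣ ≤ n →
    weightIn G (λ v → not (does (v ∈? X))) ≤ weightIn G (λ v → does (v ∈? X))
  complement-lighter noLoops deg≥3 {X} fvs small =
    lighter (weightIn G χ) (weightIn G B) (size χ) (size B) degree-bound 3x≤b
    where
    χ B : Fin n → Bool
    χ v = does (v ∈? X)
    B v = not (χ v)
    avoid : ∀ u → B u ≡ true → u ∉ X
    avoid u Bu u∈X with u ∈? X
    ... | no u∉X = u∉X u∈X
    degree-bound : weightIn G B + 3 * size B ≤ (weightIn G χ + 3 * size χ) + 2 * size B
    degree-bound = begin
      weightIn G B + 3 * size B                      ≡⟨ weight-shift G deg≥3 B ⟩
      ∑ (λ v → mask (B v) (deg G v))                 ≤⟨ degree-split G χ ⟩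
      ∑ (λ v → mask (χ v) (deg G v)) + 2 * edgesWithin G B
                                                     ≤⟨ +-monoʳ-≤ (∑ (λ v → mask (χ v) (deg G v))) (*-monoʳ-≤ 2 (forest-sparse G noLoops fvs B avoid)) ⟩
      ∑ (λ v → mask (χ v) (deg G v)) + 2 * size B    ≡⟨ cong (_+ 2 * size B) (weight-shift G deg≥3 χ) ⟨
      (weightIn G χ + 3 * size χ) + 2 * size B       ∎
      where open ≤-Reasoning
    3x≤b : 3 * size χ ≤ size B
    3x≤b = +-cancelˡ-≤ (size χ) (3 * size χ) (size B) (begin
      4 * size χ          ≡⟨ cong (4 *_) (size-subset X) ⟩
      4 * ∣ X ∣           ≤⟨ small ⟩
      n                   ≡⟨ size-split χ ⟨
      size χ + size B     ∎)
      where open ≤-Reasoning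

  weight-on-fvs : NoLoops G → (∀ v → 3 ≤ deg G v) → ∀ {X} → IsFVS G X → 4 * ∣ X ∣ ≤ n →
    totalWeight G ≤ 2 * weightOf G X
  weight-on-fvs noLoops deg≥3 {X} fvs small = begin
    totalWeight G                                  ≡⟨ sumFin≡∑ (weight G) ⟩
    ∑ (weight G)                                   ≡⟨ sum-cong-≗ (λ v → mask-split (χ v) (weight G v)) ⟩
    ∑ (λ v → mask (χ v) (weight G v) + mask (not (χ v)) (weight G v))
                                                   ≡⟨ ∑-distrib-+ (λ v → mask (χ v) (weight G v)) (λ v → mask (not (χ v)) (weight G v)) ⟩
    weightIn G χ + weightIn G (not ∘ χ)            ≤⟨ +-monoʳ-≤ (weightIn G χ) (complement-lighter noLoops deg≥3 fvs small) ⟩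
    weightIn G χ + weightIn G χ                    ≡⟨ cong (λ w → w + w) (sumFin≡∑ (λ v → mask (χ v) (weight G v))) ⟨
    weightOf G X + weightOf G X                    ≡⟨ cong (weightOf G X +_) (+-identityʳ (weightOf G X)) ⟨
    2 * weightOf G X                               ∎
    where
    open ≤-Reasoning
    χ : Fin n → Bool
    χ v = does (v ∈? X)

any-function? : ∀ m {p} (P : (Fin m → Fin p) → Set) →
  (∀ {f g} → (∀ i → f i ≡ g i) → P f → P g) → (∀ f → Dec (P f)) → Dec (Σ (Fin m → Fin p) P)
any-function? zero P resp P? with P? (λ ())
... | yes Pf = yes (_ , Pf)
... | no ¬Pf = no λ (f , Pf) → ¬Pf (resp (λ ()) Pf)
any-function? (suc m) {p} P resp P?
  with any? (λ a → any-function? m (P ∘ cons a) (λ f≗g → resp (cons-cong f≗g)) (P? ∘ cons a))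
  where
  cons : Fin p → (Fin m → Fin p) → Fin (suc m) → Fin p
  cons a f zero    = a
  cons a f (suc i) = f i
  cons-cong : ∀ {a f g} → (∀ i → f i ≡ g i) → ∀ i → cons a f i ≡ cons a g i
  cons-cong f≗g zero    = refl
  cons-cong f≗g (suc i) = f≗g i
... | yes (a , f , Pf) = yes (_ , Pf)
... | no none = no λ (f , Pf) → none (f zero , f ∘ suc , resp (λ { zero → refl ; (suc i) → refl }) Pf)

injective? : ∀ {m p} (f : Fin m → Fin p) → Dec (Injective _≡_ _≡_ f)
injective? f with all? (λ x → all? (λ y → (f x ≟ f y) →-dec (x ≟ y)))
... | yes inj = yes (λ {x} {y} → inj x y)
... | no ¬inj = no (λ inj → ¬inj (λ x y → inj))

module _ {n} (G : Graph n) (F : Subset n) where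

  IsCycle : ∀ k → (Fin (suc k) → Fin n) → (Fin (suc k) → Fin (nE G)) → Set
  IsCycle k vs es = Injective _≡_ _≡_ vs × Injective _≡_ _≡_ es ×
                    (∀ i → vs i ∉ F) × (∀ i → Joins G (es i) (vs i) (vs (next i)))

  -- IsCycle respects pointwise equality of the sequences (there is no
  -- function extensionality, so the search below needs this explicitly).
  IsCycle-resp : ∀ k {vs vs′ es es′} → (∀ i → vs i ≡ vs′ i) → (∀ i → es i ≡ es′ i) →
    IsCycle k vs es → IsCycle k vs′ es′
  IsCycle-resp k {vs} {vs′} {es} {es′} vs≗ es≗ (vsInj , esInj , out , link) =
    (λ {x} {y} eq → vsInj (trans (vs≗ x) (trans eq (sym (vs≗ y))))) ,
    (λ {x} {y} eq → esInj (trans (es≗ x) (trans eq (sym (es≗ y))))) ,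
    (λ i → subst (_∉ F) (vs≗ i) (out i)) ,
    (λ i → subst₂ (Joins G (es′ i)) (vs≗ i) (vs≗ (next i)) (subst (λ e → Joins G e (vs i) (vs (next i))) (es≗ i) (link i)))

  CycleOfLength : ℕ → Set
  CycleOfLength k = Σ (Fin (suc k) → Fin n) λ vs → Σ (Fin (suc k) → Fin (nE G)) (IsCycle k vs)

  IsCycle? : ∀ k vs es → Dec (IsCycle k vs es)
  IsCycle? k vs es =
    injective? vs ×-dec injective? es ×-dec all? (λ i → ¬? (vs i ∈? F)) ×-dec
    all? (λ i → ≡-dec _≟_ _≟_ (ends G (es i)) (vs i , vs (next i)) ⊎-dec
                ≡-dec _≟_ _≟_ (ends G (es i)) (vs (next i) , vs i))

  cycle-of-length? : ∀ k → Dec (CycleOfLength k)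
  cycle-of-length? k =
    any-function? (suc k) (λ vs → Σ (Fin (suc k) → Fin (nE G)) (IsCycle k vs))
      (λ vs≗ (es , isCycle) → es , IsCycle-resp k vs≗ (λ _ → refl) isCycle)
      (λ vs → any-function? (suc k) (IsCycle k vs) (IsCycle-resp k (λ _ → refl)) (IsCycle? k vs))

  -- Cycles have at most n vertices, so only finitely many lengths are tried.
  cycle? : Dec (CycleAvoiding G F)
  cycle? = Dec.map′ fromLength toLength (any? (λ (k : Fin n) → cycle-of-length? (toℕ k)))
    where
    fromLength : ∃ (λ (k : Fin n) → CycleOfLength (toℕ k)) → CycleAvoiding G F
    fromLength (k , vs , es , vsInj , esInj , out , link) =
      record { k = toℕ k ; vs = vs ; es = es ; vsInj = vsInj ; esInj = esInj ; vsOut = out ; link = link }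
    toLength : CycleAvoiding G F → ∃ (λ (k : Fin n) → CycleOfLength (toℕ k))
    toLength C = fromℕ< k<n , subst CycleOfLength (sym (toℕ-fromℕ< k<n)) (vs , es , vsInj , esInj , vsOut , link)
      where
      open CycleAvoiding C
      k<n : k < n
      k<n = injective⇒≤ vsInj

inSmallFVS? : ∀ {n} (G : Graph n) k v → Dec (InSmallFVS G k v)
inSmallFVS? G k v = anySubset? (λ F → ¬? (cycle? G F) ×-dec (∣ F ∣ ≤? k) ×-dec (v ∈? F))

comprehension : ∀ {n} {P : Fin n → Set} → (∀ v → Dec (P v)) →
  Σ (Subset n) λ S → (∀ v → v ∈ S → P v) × (∀ v → P v → v ∈ S)
comprehension {P = P} P? = tabulate (does ∘ P?) , sound , complete
  where
  sound : ∀ v → v ∈ tabulate (does ∘ P?) → P v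
  sound v v∈S with P? v | trans (sym (lookup∘tabulate (does ∘ P?) v)) ([]=⇒lookup v∈S)
  ... | yes Pv | _ = Pv
  complete : ∀ v → P v → v ∈ tabulate (does ∘ P?)
  complete v Pv with P? v in eq
  ... | yes _ = lookup⇒[]= v _ (trans (lookup∘tabulate (does ∘ P?) v) (cong does eq))
  ... | no ¬Pv = ⊥-elim (¬Pv Pv)

weightOf-mono : ∀ {n} (G : Graph n) {X S} → X ⊆ S → weightOf G X ≤ weightOf G S
weightOf-mono {n} G {X} {S} X⊆S = begin
  weightOf G X                                       ≡⟨ sumFin≡∑ (λ v → mask (does (v ∈? X)) (weight G v)) ⟩
  ∑ (λ v → mask (does (v ∈? X)) (weight G v))        ≤⟨ ∑-mono pointwise ⟩
  ∑ (λ v → mask (does (v ∈? S)) (weight G v))        ≡⟨ sumFin≡∑ (λ v → mask (does (v ∈? S)) (weight G v)) ⟨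
  weightOf G S                                       ∎
  where
  open ≤-Reasoning
  pointwise : ∀ v → mask (does (v ∈? X)) (weight G v) ≤ mask (does (v ∈? S)) (weight G v)
  pointwise v with v ∈? X | v ∈? S
  ... | no _    | _       = z≤n
  ... | yes _   | yes _   = ≤-refl
  ... | yes v∈X | no v∉S = ⊥-elim (v∉S (X⊆S v∈X))

-- S contains the given small feedback vertex set X, which
-- already carries at least half of the total weight.
lemma5 : ∀ (n k : ℕ) (G : Graph n) →
    NoLoops G →
    (∀ u v → mult G u v ≤ 2) →
    (∀ v → 3 ≤ deg G v) →
    (∃ λ v → 4 ≤ deg G v) →
    4 * k ≤ n →
    (Σ (Subset n) λ F → IsFVS G F × ∣ F ∣ ≤ k) →
    Σ (Subset n) λ S →
      (∀ v → v ∈ S → InSmallFVS G k v) ×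
      (∀ v → InSmallFVS G k v → v ∈ S) ×
      totalWeight G ≤ 2 * weightOf G S
lemma5 n k G noLoops _ deg≥3 _ 4k≤n (X , fvs , |X|≤k) = add-weight (comprehension (inSmallFVS? G k))
  where
  add-weight : (Σ (Subset n) λ S → (∀ v → v ∈ S → InSmallFVS G k v) × (∀ v → InSmallFVS G k v → v ∈ S)) →
    Σ (Subset n) λ S → (∀ v → v ∈ S → InSmallFVS G k v) × (∀ v → InSmallFVS G k v → v ∈ S) ×
                       totalWeight G ≤ 2 * weightOf G S
  add-weight (S , sound , complete) = S , sound , complete , (begin
    totalWeight G       ≤⟨ weight-on-fvs G noLoops deg≥3 fvs (≤-trans (*-monoʳ-≤ 4 |X|≤k) 4k≤n) ⟩
    2 * weightOf G X    ≤⟨ *-monoʳ-≤ 2 (weightOf-mono G (λ {v} v∈X → complete v (X , fvs , |X|≤k , v∈X))) ⟩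
    2 * weightOf G S    ∎)
    where open ≤-Reasoning
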